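{- Let $G=(A\cup B,E)$ be a marriage instance with strict preferences, and suppose the graph $H$ admits a legal stable matching. Let $S_0$ be the $(A_L\cup B_L)$-optimal legal stable matching of $H$, and let $A_-=\{a\in A: (a_\ell^-,b_r^+)\in S_0\text{ for some }b\in B\}$ and $A'_+=\{a\in A:(b_\ell^-,a_r^+)\in S_0\text{ for some }b\in B\}$. Let $N$ be a fully popular matching in $G$ and let $\vec\alpha$ be any witness of $N$. Then $\alpha_a=0$ for every $a\in A_-\cap A'_+$.
   Context: $G=(A\cup B,E)$ is bipartite, every vertex has a strict ranking of its neighbors. Augment $G$ with a self-loop $(u,u)$ at every vertex, ranked last by $u$; $E'=E\cup\{(u,u)\}$; matchings are viewed as perfect matchings of $(A\cup B,E')$ (uncovered vertices matched to themselves). For matchings $M,N$, $\phi(M,N)$ (resp. $\phi_A(M,N)$) is the number of vertices of $A\cup B$ (resp. of $A$) that get a better assignment in $M$ than in $N$. $M$ is popular if $\phi(M,N)\ge\phi(N,M)$ for all $N$, $A$-popular if $\phi_A(M,N)\ge\phi_A(N,M)$ for all $N$, fully popular if both. For a perfect matching $N$ of $(A\cup B,E')$ define $\mathsf{wt}_N$: for $(a,b)\in E$, $\mathsf{wt}_N(a,b)=2$ if $a$ and $b$ both prefer each other to their partners in $N$, $-2$ if both prefer their partners in $N$ to each other, and $0$ otherwise; for a self-loop, $\mathsf{wt}_N(u,u)=0$ if $(u,u)\in N$ and $-1$ otherwise. A witness of a popular matching $N$ is a vector $\vec\alpha\in\{0,\pm1\}^{A\cup B}$ with $\sum_u\alpha_u=0$,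 $\alpha_a+\alpha_b\ge\mathsf{wt}_N(a,b)$ for all $(a,b)\in E$, and $\alpha_u\ge\mathsf{wt}_N(u,u)$ for all $u$. For $a\in A$, $f(a)$ is $a$'s top-ranked neighbor, and $s(a)$ is $a$'s most preferred neighbor in $E'$ (possibly $a$ itself) that is not $f(a')$ for any $a'\in A$. Valid: elements of $\{(a,f(a)),(a,s(a)):a\in A\}$ and self-loops $(b,b)$ with $b\in B$, $b\ne f(a)$ for all $a$. An edge $(a,b)\in E$ is popular if some popular matching contains it; $(u,u)$ is popular if some popular matching leaves $u$ unmatched. Legal = valid and popular. The graph $H$: vertices $u_\ell,u_r$ for each $u\in A\cup B$; $A_L=\{a_\ell\}$, $B_L=\{b_\ell\}$ (left side), $A_R,B_R$ (right side). For each $(a,b)\in E$, edges $(a_\ell^+,b_r^-)$, $(a_\ell^-,b_r^+)$, $(b_\ell^+,a_r^-)$, $(b_\ell^-,a_r^+)$; for each $u$, an edge $(u_\ell^-,u_r^+)$. Preferences: if $u$ ranks $v\succ v'\succ\cdots\succ v''$ in $G$, then $u_\ell$ ranks $v_r^-\succ\cdots\succ v_r''^-\succ v_r^+\succ\cdots\succ v_r''^+\succ u_r^+$ and $u_r$ ranks $v_\ell^-\succ\cdots\succ v_\ell''^-\succ u_\ell^-\succ v_\ell^+\succ\cdots\succ v_\ell''^+$ (here $y^\tau$ denotes the edge to $y$ on which $y$'s endpoint has superscript $\tau$). An edge $(x^\sigma,y^\tau)$ blocks a matching if $x$ prefers $y^\tau$ and $y$ prefers $x^\sigma$ to their current assignments;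 stable = no blocking edge. Forbidden edges of $H$: the four edges from a non-legal $(a,b)\in E$, and $(u_\ell^-,u_r^+)$ for non-legal $(u,u)$. A matching of $H$ is legal if it has no forbidden edge. The $(A_L\cup B_L)$-optimal legal stable matching is the legal stable matching of $H$ in which every vertex of $A_L\cup B_L$ is matched along the edge it most prefers among the edges it is matched along in all legal stable matchings of $H$. -}

module Defs where

open import Data.Nat using (ℕ; zero; suc; _+_; _≤_; _<_; _<ᵇ_)
open import Data.Fin using (Fin)
import Data.Fin as Fin
open import Data.Bool using (Bool; true; false; T; if_then_else_)
open import Data.Maybe using (Maybe; just; nothing)
open import Data.List using (List; foldr; map; allFin)
open import Data.Integer as ℤ using (ℤ; +_; -_)
open import Data.Sum using (_⊎_; inj₁; inj₂)
open import Data.Sum.Properties using (≡-dec)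
open import Data.Product using (Σ; _×_; _,_)
open import Data.Empty using (⊥)
open import Relation.Nullary using (¬_; does)
open import Relation.Binary.PropositionalEquality using (_≡_)

-- A marriage instance G = (A ∪ B, E), A = Fin m, B = Fin n.
-- rkA a b : position of b in a's list (smaller = more preferred);
-- only meaningful for neighbours; strictness = injective on neighbours.

record Instance : Set where
  field
    m n     : ℕ
    E       : Fin m → Fin n → Bool
    rkA     : Fin m → Fin n → ℕ
    rkB     : Fin n → Fin m → ℕ
    strictA : ∀ a b b' → T (E a b) → T (E a b') → rkA a b ≡ rkA a b' → b ≡ b'
    strictB : ∀ b a a' → T (E a b) → T (E a' b) → rkB b a ≡ rkB b a' → a ≡ a'

count : ∀ {k} → (Fin k → Bool) → ℕ
count {k} p = foldr _+_ 0 (map (λ i → if p i then 1 else 0) (allFin k))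

sumℤ : ∀ {k} → (Fin k → ℤ) → ℤ
sumℤ {k} f = foldr ℤ._+_ (+ 0) (map f (allFin k))

data Sign : Set where
  plus minus : Sign

_<ₗ_ : ℕ × ℕ → ℕ × ℕ → Set
(t , r) <ₗ (t' , r') = (t < t') ⊎ ((t ≡ t') × (r < r'))

module _ (G : Instance) where
  open Instance G

  V : Set
  V = Fin m ⊎ Fin n

  -- Matchings of G, seen as perfect matchings of (A ∪ B, E'):
  -- nothing = matched to itself (self-loop).
  record Matching : Set where
    field
      mA   : Fin m → Maybe (Fin n)
      mB   : Fin n → Maybe (Fin m)
      inE  : ∀ a b → mA a ≡ just b → T (E a b)
      consAB : ∀ a b → mA a ≡ just b → mB b ≡ just a
      consBA : ∀ a b → mB b ≡ just a → mA a ≡ just b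
  open Matching public

  prefA : Fin m → Maybe (Fin n) → Maybe (Fin n) → Bool
  prefA a (just b) (just b') = rkA a b <ᵇ rkA a b'
  prefA a (just b) nothing   = true
  prefA a nothing  _         = false

  prefB : Fin n → Maybe (Fin m) → Maybe (Fin m) → Bool
  prefB b (just a) (just a') = rkB b a <ᵇ rkB b a'
  prefB b (just a) nothing   = true
  prefB b nothing  _         = false

  φA : Matching → Matching → ℕ
  φA M N = count (λ a → prefA a (mA M a) (mA N a))

  φ : Matching → Matching → ℕ
  φ M N = φA M N + count (λ b → prefB b (mB M b) (mB N b))

  Popular : Matching → Set
  Popular M = ∀ N → φ N M ≤ φ M N

  APopular : Matching → Set
  APopular M = ∀ N → φA N M ≤ φA M N

  FullyPopular : Matching → Set
  FullyPopular M = Popular M × APopular M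

  wt : Matching → Fin m → Fin n → ℤ
  wt N a b with prefA a (just b) (mA N a) | prefB b (just a) (mB N b)
  ... | true | true = + 2
  ... | _    | _    with prefA a (mA N a) (just b) | prefB b (mB N b) (just a)
  ...    | true | true = - (+ 2)
  ...    | _    | _    = + 0

  wtLoopA : Matching → Fin m → ℤ
  wtLoopA N a with mA N a
  ... | nothing = + 0
  ... | just _  = - (+ 1)

  wtLoopB : Matching → Fin n → ℤ
  wtLoopB N b with mB N b
  ... | nothing = + 0
  ... | just _  = - (+ 1)

  wtLoop : Matching → V → ℤ
  wtLoop N (inj₁ a) = wtLoopA N a
  wtLoop N (inj₂ b) = wtLoopB N b

  Witness : Matching → (V → ℤ) → Set
  Witness N α =
    (∀ u → (α u ≡ - (+ 1)) ⊎ (α u ≡ + 0) ⊎ (α u ≡ + 1)) ×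
    (sumℤ (λ a → α (inj₁ a)) ℤ.+ sumℤ (λ b → α (inj₂ b)) ≡ + 0) ×
    (∀ a b → T (E a b) → wt N a b ℤ.≤ α (inj₁ a) ℤ.+ α (inj₂ b)) ×
    (∀ u → wtLoop N u ℤ.≤ α u)

  IsF : Fin m → Fin n → Set
  IsF a b = T (E a b) × (∀ b' → T (E a b') → rkA a b ≤ rkA a b')

  IsFImage : Fin n → Set
  IsFImage b = Σ (Fin m) λ a → IsF a b

  -- IsS a (just b) : s(a) = b ;  IsS a nothing : s(a) = a
  IsS : Fin m → Maybe (Fin n) → Set
  IsS a (just b) = T (E a b) × ¬ IsFImage b ×
                   (∀ b' → T (E a b') → ¬ IsFImage b' → rkA a b ≤ rkA a b')
  IsS a nothing  = ∀ b' → T (E a b') → IsFImage b'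

  ValidEdge : Fin m → Fin n → Set
  ValidEdge a b = IsF a b ⊎ IsS a (just b)

  ValidLoop : V → Set
  ValidLoop (inj₁ a) = IsS a nothing
  ValidLoop (inj₂ b) = ¬ IsFImage b

  PopularEdge : Fin m → Fin n → Set
  PopularEdge a b = Σ Matching λ M → Popular M × (mA M a ≡ just b)

  PopularLoop : V → Set
  PopularLoop (inj₁ a) = Σ Matching λ M → Popular M × (mA M a ≡ nothing)
  PopularLoop (inj₂ b) = Σ Matching λ M → Popular M × (mB M b ≡ nothing)

  LegalEdge : Fin m → Fin n → Set
  LegalEdge a b = ValidEdge a b × PopularEdge a b

  LegalLoop : V → Set
  LegalLoop u = ValidLoop u × PopularLoop u

  -- The graph H.  An edge of H is a triple (u , v , σ) standing for
  -- the edge (u_ℓ^σ , v_r^{-σ}).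
  AdjV : V → V → Set
  AdjV (inj₁ a) (inj₂ b) = T (E a b)
  AdjV (inj₂ b) (inj₁ a) = T (E a b)
  AdjV (inj₁ _) (inj₁ _) = ⊥
  AdjV (inj₂ _) (inj₂ _) = ⊥

  IsHEdge : V → V → Sign → Set
  IsHEdge u v σ = AdjV u v ⊎ ((u ≡ v) × (σ ≡ minus))

  rankV : V → V → ℕ
  rankV (inj₁ a) (inj₂ b) = rkA a b
  rankV (inj₂ b) (inj₁ a) = rkB b a
  rankV _        _        = 0

  sameV : V → V → Bool
  sameV u v = does (≡-dec Fin._≟_ Fin._≟_ u v)

  -- key of edge (u_ℓ^σ, v_r^{-σ}) in u_ℓ's list (smaller = better):
  -- u_ℓ : v_r^- (σ = plus) ≻ v_r^+ (σ = minus, v ≠ u) ≻ u_r^+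
  keyL : V → V → Sign → ℕ × ℕ
  keyL u v plus  = (0 , rankV u v)
  keyL u v minus = if sameV u v then (2 , 0) else (1 , rankV u v)

  -- key of edge (u_ℓ^σ, v_r^{-σ}) in v_r's list:
  -- v_r : u_ℓ^- (σ = minus, u ≠ v) ≻ v_ℓ^- ≻ u_ℓ^+ (σ = plus)
  keyR : V → V → Sign → ℕ × ℕ
  keyR u v minus = if sameV u v then (1 , 0) else (0 , rankV v u)
  keyR u v plus  = (2 , rankV v u)

  record HMatching : Set₁ where
    field
      S     : V → V → Sign → Set
      sub   : ∀ u v σ → S u v σ → IsHEdge u v σ
      uniqL : ∀ u v σ v' σ' → S u v σ → S u v' σ' → (v ≡ v') × (σ ≡ σ')
      uniqR : ∀ u v σ u' σ' → S u v σ → S u' v σ' → (u ≡ u') × (σ ≡ σ')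
  open HMatching public

  Blocks : HMatching → V → V → Sign → Set
  Blocks M u v σ =
    IsHEdge u v σ ×
    (∀ v' σ' → S M u v' σ' → keyL u v σ <ₗ keyL u v' σ') ×
    (∀ u' σ' → S M u' v σ' → keyR u v σ <ₗ keyR u' v σ')

  Stable : HMatching → Set
  Stable M = ∀ u v σ → ¬ Blocks M u v σ

  LegalH : V → V → Sign → Set
  LegalH (inj₁ a) (inj₂ b) _ = LegalEdge a b
  LegalH (inj₂ b) (inj₁ a) _ = LegalEdge a b
  LegalH u        _        _ = LegalLoop u   -- same-side edges are self edges

  LegalMatching : HMatching → Set
  LegalMatching M = ∀ u v σ → S M u v σ → LegalH u v σ

  LegalStable : HMatching → Set
  LegalStable M = LegalMatching M × Stable M

  LeftOptimal : HMatching → Set₁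
  LeftOptimal S₀ =
    LegalStable S₀ ×
    (∀ T → LegalStable T → ∀ u v σ → S T u v σ →
       Σ V λ v₀ → Σ Sign λ σ₀ → S S₀ u v₀ σ₀ ×
         (((v₀ ≡ v) × (σ₀ ≡ σ)) ⊎ (keyL u v₀ σ₀ <ₗ keyL u v σ)))

{-# OPTIONS --safe #-}
-- From N and its witness α one lifts a matching of H: partners u, w of N give the edge
-- (u_ℓ^s, w_r^-s) with s = + exactly when α_u = 1, and a vertex u left alone by N gives (u_ℓ^-, u_r^+).
-- A-popularity of N makes every edge of N valid and popularity makes it popular, so this matching is
-- legal; the witness inequalities together with complementary slackness (α_u + α_w = 0 on edges of N,
-- α_u = 0 on vertices left alone) make it stable.  Now let a ∈ A₋ ∩ A′₊.  If α_a = 1, a_ℓ is matched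
-- along a +-edge, which it prefers to its −-edge in S₀, against the optimality of S₀.  If α_a = −1, the
-- partner w of a has α_w = 1, so a_r is matched to w_ℓ^+.  By optimality b_ℓ weakly prefers its S₀-edge
-- (b_ℓ^-, a_r^+) to its lifted edge; the two differ since a_r is taken, and a_r prefers b_ℓ^- to w_ℓ^+,
-- so (b_ℓ^-, a_r^+) blocks the lifted matching.
module Submission where

open import Defs
open import Data.Nat using (ℕ; zero; suc; _+_; _≤_; _<_; z≤n; s≤s)
import Data.Nat.Properties as ℕP
open import Data.Fin using (Fin; zero; suc; _≟_; punchIn)
open import Data.Fin.Properties using (any?; all?; 0≢1+n; suc-injective; punchInᵢ≢i)
open import Data.Bool using (Bool; true; false; T; if_then_else_)
open import Data.Bool.Properties using (T-≡)
open import Data.Maybe using (Maybe; just; nothing)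
open import Data.Maybe.Properties using (just-injective)
import Data.Maybe.Properties as Maybe
open import Data.List using (foldr; map; allFin)
open import Data.List.Properties using (map-tabulate)
open import Data.Integer as ℤ using (ℤ; +_; -_; +≤+)
import Data.Integer.Properties as ℤP
open import Data.Sum using (_⊎_; inj₁; inj₂; [_,_]; swap)
import Data.Sum.Properties
open import Data.Product using (Σ; ∃; _×_; _,_; proj₁; proj₂)
open import Data.Empty using (⊥; ⊥-elim)
open import Function using (_∘_; id; Equivalence)
open import Relation.Nullary using (¬_; Dec; yes; no; does)
open import Relation.Nullary.Decidable using (T?; _×-dec_; _→-dec_; dec-true; dec-false)
open import Relation.Binary.PropositionalEquality
  using (_≡_; _≢_; refl; sym; trans; cong; cong₂; subst; subst₂; module ≡-Reasoning)
open import Algebra.Properties.CommutativeMonoid.Sum ℤP.+-0-commutativeMonoid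
  using (sum; ∑-comm; ∑-distrib-+; sum-remove; sum-cong-≗; sum-replicate-zero)
open import Algebra.Properties.AbelianGroup ℤP.+-0-abelianGroup
  using (inverseˡ-unique; inverseʳ-unique)

if-yes : ∀ {p} {P : Set p} {A : Set} (d : Dec P) {x y : A} → P → (if does d then x else y) ≡ x
if-yes d p rewrite dec-true d p = refl

if-no : ∀ {p} {P : Set p} {A : Set} (d : Dec P) {x y : A} → ¬ P → (if does d then x else y) ≡ y
if-no d ¬p rewrite dec-false d ¬p = refl

just≢nothing : ∀ {A : Set} {x : A} → just x ≢ nothing
just≢nothing ()

T⇒≡true : ∀ {x} → T x → x ≡ true
T⇒≡true = Equivalence.to T-≡

¬T⇒≡false : ∀ {x} → ¬ T x → x ≡ false
¬T⇒≡false {false} _  = refl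
¬T⇒≡false {true}  ¬t = ⊥-elim (¬t _)

foldr-map-allFin : ∀ {A B : Set} (c : A → B → B) (e : B) {k} (f : Fin (suc k) → A) →
                   foldr c e (map f (allFin (suc k))) ≡ c (f zero) (foldr c e (map (f ∘ suc) (allFin k)))
foldr-map-allFin c e f =
  cong (c (f zero) ∘ foldr c e) (trans (map-tabulate suc f) (sym (map-tabulate id (f ∘ suc))))

count-suc : ∀ {k} (p : Fin (suc k) → Bool) → count p ≡ (if p zero then 1 else 0) + count (p ∘ suc)
count-suc p = foldr-map-allFin _+_ 0 (λ i → if p i then 1 else 0)

count-none : ∀ {k} (p : Fin k → Bool) → (∀ i → ¬ T (p i)) → count p ≡ 0
count-none {zero}  p none = refl
count-none {suc k} p none rewrite count-suc p with p zero | none zero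
... | true  | ¬p₀ = ⊥-elim (¬p₀ _)
... | false | _   = count-none (p ∘ suc) (none ∘ suc)

count-≤1 : ∀ {k} (p : Fin k → Bool) → (∀ i j → T (p i) → T (p j) → i ≡ j) → count p ≤ 1
count-≤1 {zero}  p unique = z≤n
count-≤1 {suc k} p unique rewrite count-suc p with p zero in p₀
... | true  rewrite count-none (p ∘ suc) (λ i pᵢ → 0≢1+n (unique zero (suc i) (subst T (sym p₀) _) pᵢ))
  = s≤s z≤n
... | false = count-≤1 (p ∘ suc) (λ i j pᵢ pⱼ → suc-injective (unique (suc i) (suc j) pᵢ pⱼ))

count-≥1 : ∀ {k} (p : Fin k → Bool) (i : Fin k) → T (p i) → 1 ≤ count p
count-≥1 p zero pᵢ rewrite count-suc p with p zero
... | true = s≤s z≤n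
count-≥1 p (suc i) pᵢ rewrite count-suc p =
  ℕP.≤-trans (count-≥1 (p ∘ suc) i pᵢ) (ℕP.m≤n+m _ _)

count-≥2 : ∀ {k} (p : Fin k → Bool) (i j : Fin k) → i ≢ j → T (p i) → T (p j) → 2 ≤ count p
count-≥2 p zero    zero    i≢j _  _  = ⊥-elim (i≢j refl)
count-≥2 p zero    (suc j) _   pᵢ pⱼ rewrite count-suc p with p zero
... | true = s≤s (count-≥1 (p ∘ suc) j pⱼ)
count-≥2 p (suc i) zero    _   pᵢ pⱼ rewrite count-suc p with p zero
... | true = s≤s (count-≥1 (p ∘ suc) i pᵢ)
count-≥2 p (suc i) (suc j) i≢j pᵢ pⱼ rewrite count-suc p =
  ℕP.≤-trans (count-≥2 (p ∘ suc) i j (i≢j ∘ cong suc) pᵢ pⱼ) (ℕP.m≤n+m _ _)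

sumℤ≡sum : ∀ {k} (f : Fin k → ℤ) → sumℤ f ≡ sum f
sumℤ≡sum {zero}  f = refl
sumℤ≡sum {suc k} f = trans (foldr-map-allFin ℤ._+_ (+ 0) f) (cong (ℤ._+_ (f zero)) (sumℤ≡sum (f ∘ suc)))

sum-zero : ∀ {k} (f : Fin k → ℤ) → (∀ i → f i ≡ + 0) → sum f ≡ + 0
sum-zero {k} f f≡0 = trans (sum-cong-≗ f≡0) (sum-replicate-zero k)

sum-single : ∀ {k} (f : Fin k → ℤ) (j : Fin k) → (∀ i → i ≢ j → f i ≡ + 0) → sum f ≡ f j
sum-single {suc k} f j off = begin
  sum f                        ≡⟨ sum-remove {i = j} f ⟩
  f j ℤ.+ sum (f ∘ punchIn j)  ≡⟨ cong (ℤ._+_ (f j)) (sum-zero _ (λ i → off _ (punchInᵢ≢i j i))) ⟩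
  f j ℤ.+ + 0                  ≡⟨ ℤP.+-identityʳ (f j) ⟩
  f j                          ∎
  where open ≡-Reasoning

-1⇒≤0 : ∀ {x} → x ≡ - (+ 1) → x ℤ.≤ + 0
-1⇒≤0 refl = ℤ.-≤+

x≤x+y : ∀ x {y} → + 0 ℤ.≤ y → x ℤ.≤ x ℤ.+ y
x≤x+y x 0≤y = ℤP.≤-trans (ℤP.≤-reflexive (sym (ℤP.+-identityʳ x))) (ℤP.+-monoʳ-≤ x 0≤y)

sum-nonneg : ∀ {k} (f : Fin k → ℤ) → (∀ i → + 0 ℤ.≤ f i) → + 0 ℤ.≤ sum f
sum-nonneg {zero}  f _   = ℤP.≤-refl
sum-nonneg {suc k} f f≥0 = ℤP.+-mono-≤ (f≥0 zero) (sum-nonneg (f ∘ suc) (f≥0 ∘ suc))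

nonneg-sum≤0 : ∀ {k} (f : Fin k → ℤ) → (∀ i → + 0 ℤ.≤ f i) → sum f ℤ.≤ + 0 →
               ∀ i → f i ≡ + 0
nonneg-sum≤0 {suc k} f f≥0 sum≤0 i = ℤP.≤-antisym f≤0 (f≥0 i)
  where
  f≤0 : f i ℤ.≤ + 0
  f≤0 = ℤP.≤-trans (x≤x+y (f i) (sum-nonneg (f ∘ punchIn i) (f≥0 ∘ punchIn i)))
                   (ℤP.≤-trans (ℤP.≤-reflexive (sym (sum-remove {i = i} f))) sum≤0)

Least : ∀ {k} → (Fin k → Bool) → (Fin k → ℕ) → Fin k → Set
Least P rank y = T (P y) × (∀ z → T (P z) → rank y ≤ rank z)

least-exists : ∀ {k} (P : Fin k → Bool) (rank : Fin k → ℕ) (x : Fin k) → T (P x) →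
               Σ (Fin k) (Least P rank)
least-exists P rank x Px = descend (suc (rank x)) x ℕP.≤-refl Px
  where
  descend : ∀ bound x → rank x < bound → T (P x) → Σ _ (Least P rank)
  descend zero    x ()
  descend (suc b) x x<b Px with any? (λ z → T? (P z) ×-dec (rank z ℕP.<? rank x))
  ... | yes (z , Pz , z<x) = descend b z (ℕP.≤-trans z<x (ℕP.≤-pred x<b)) Pz
  ... | no  none           = x , Px , λ z Pz → ℕP.≮⇒≥ (λ z<x → none (z , Pz , z<x))

<ₗ-fst : ∀ {t r} k → (t , r) <ₗ k → t ≤ proj₁ k
<ₗ-fst (t' , r') (inj₁ t<t')       = ℕP.<⇒≤ t<t'
<ₗ-fst (t' , r') (inj₂ (refl , _)) = ℕP.≤-refl

<ₗ-snd : ∀ {t r r'} → (t , r) <ₗ (t , r') → r < r'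
<ₗ-snd (inj₁ t<t)      = ⊥-elim (ℕP.<-irrefl refl t<t)
<ₗ-snd (inj₂ (_ , r<r')) = r<r'

<ₗ-irrefl : ∀ {k} → ¬ (k <ₗ k)
<ₗ-irrefl {t , r} lt = ℕP.<-irrefl refl (<ₗ-snd lt)

module _ (G : Instance) where
  open Instance G

  prefA-irrefl : ∀ a x → ¬ T (prefA G a x x)
  prefA-irrefl a (just b) b<b = ℕP.<-irrefl refl (ℕP.<ᵇ⇒< (rkA a b) (rkA a b) b<b)

  prefA-asym : ∀ a x y → T (prefA G a x y) → ¬ T (prefA G a y x)
  prefA-asym a (just b) (just b') b<b' b'<b =
    ℕP.<-asym (ℕP.<ᵇ⇒< (rkA a b) (rkA a b') b<b') (ℕP.<ᵇ⇒< (rkA a b') (rkA a b) b'<b)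

  prefB-asym : ∀ b x y → T (prefB G b x y) → ¬ T (prefB G b y x)
  prefB-asym b (just a) (just a') a<a' a'<a =
    ℕP.<-asym (ℕP.<ᵇ⇒< (rkB b a) (rkB b a') a<a') (ℕP.<ᵇ⇒< (rkB b a') (rkB b a) a'<a)

  module _ (N : Matching G) (a : Fin m) (b : Fin n) where

    wt-mutual : T (prefA G a (just b) (mA N a)) → T (prefB G b (just a) (mB N b)) → wt G N a b ≡ + 2
    wt-mutual a⇝b b⇝a rewrite T⇒≡true a⇝b | T⇒≡true b⇝a = refl

    wt-nonneg : T (prefA G a (just b) (mA N a)) ⊎ T (prefB G b (just a) (mB N b)) → + 0 ℤ.≤ wt G N a b
    wt-nonneg (inj₁ a⇝b) = from-A (T⇒≡true a⇝b) (¬T⇒≡false (prefA-asym a (just b) (mA N a) a⇝b))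
      where
      from-A : prefA G a (just b) (mA N a) ≡ true → prefA G a (mA N a) (just b) ≡ false →
               + 0 ℤ.≤ wt G N a b
      from-A a⇝b a⇜b rewrite a⇝b with prefB G b (just a) (mB N b)
      ... | true  = +≤+ z≤n
      ... | false rewrite a⇜b = +≤+ z≤n
    wt-nonneg (inj₂ b⇝a) = from-B (T⇒≡true b⇝a) (¬T⇒≡false (prefB-asym b (just a) (mB N b) b⇝a))
      where
      from-B : prefB G b (just a) (mB N b) ≡ true → prefB G b (mB N b) (just a) ≡ false →
               + 0 ℤ.≤ wt G N a b
      from-B b⇝a b⇜a rewrite b⇝a with prefA G a (just b) (mA N a)
      ... | true  = +≤+ z≤n
      ... | false rewrite b⇜a with prefA G a (mA N a) (just b)
      ...   | true  = +≤+ z≤n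
      ...   | false = +≤+ z≤n

    wt-matched : mA N a ≡ just b → wt G N a b ≡ + 0
    -- The second test in the definition of wt only appears once the first one has been decided.
    wt-matched Na≡b rewrite Na≡b | ¬T⇒≡false (prefA-irrefl a (just b))
                          | Na≡b | ¬T⇒≡false (prefA-irrefl a (just b)) = refl

  matchingFromA : (f : Fin m → Maybe (Fin n)) → (∀ a b → f a ≡ just b → T (E a b)) →
                  (∀ a a' b → f a ≡ just b → f a' ≡ just b → a ≡ a') → Matching G
  matchingFromA f f⊆E f-inj = record
    { mA = f ; mB = λ b → holder b (any? (λ a → Maybe.≡-dec _≟_ (f a) (just b))) ; inE = f⊆E
    ; consAB = λ a b fa≡b → holder-of a b _ fa≡b ; consBA = λ a b h → of-holder a b _ h }
    where
    holder : ∀ b → Dec (∃ λ a → f a ≡ just b) → Maybe (Fin m)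
    holder b (yes (a , _)) = just a
    holder b (no _)        = nothing

    holder-of : ∀ a b d → f a ≡ just b → holder b d ≡ just a
    holder-of a b (yes (a' , fa'≡b)) fa≡b = cong just (f-inj a' a b fa'≡b fa≡b)
    holder-of a b (no none)          fa≡b = ⊥-elim (none (a , fa≡b))

    of-holder : ∀ a b d → holder b d ≡ just a → f a ≡ just b
    of-holder a b (yes (.a , fa≡b)) refl = fa≡b

  IsF? : ∀ a b → Dec (IsF G a b)
  IsF? a b = T? (E a b) ×-dec all? (λ b' → T? (E a b') →-dec (rkA a b ℕP.≤? rkA a b'))

  IsFImage? : ∀ b → Dec (IsFImage G b)
  IsFImage? b = any? (λ a → IsF? a b)

  f-exists : ∀ {a b} → T (E a b) → Σ (Fin n) (IsF G a)
  f-exists {a} {b} ab = least-exists (E a) (rkA a) b ab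

  f-preferred : ∀ (N : Matching G) {a y} → IsF G a y → mA N a ≢ just y → T (prefA G a (just y) (mA N a))
  f-preferred N {a} {y} (ay , y-first) Na≢y with mA N a in Na
  ... | nothing = _
  ... | just x  = ℕP.<⇒<ᵇ (ℕP.≤∧≢⇒< (y-first x (inE N a x Na))
                                    (λ y≡x → Na≢y (cong just (sym (strictA a y x ay (inE N a x Na) y≡x)))))

  -- An A-popular matching only uses valid edges

  module FromAPopularity (N : Matching G) (apop : APopular G N) where

    N-injective : ∀ {a a' b} → mA N a ≡ just b → mA N a' ≡ just b → a ≡ a'
    N-injective {a} {a'} {b} Na≡b Na'≡b =
      just-injective (trans (sym (consAB N a b Na≡b)) (consAB N a' b Na'≡b))

    Better Worse : Matching G → Fin m → Set
    Better N' a = T (prefA G a (mA N' a) (mA N a))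
    Worse  N' a = T (prefA G a (mA N a) (mA N' a))

    ¬one-better-none-worse : ∀ N' x → Better N' x → (∀ y → ¬ Worse N' y) → ⊥
    ¬one-better-none-worse N' x better none = ℕP.<-irrefl refl (begin
      1            ≤⟨ count-≥1 _ x better ⟩
      φA G N' N    ≤⟨ apop N' ⟩
      φA G N N'    ≡⟨ count-none _ none ⟩
      0            ∎)
      where open ℕP.≤-Reasoning

    ¬two-better-one-worse : ∀ N' x₁ x₂ → x₁ ≢ x₂ → Better N' x₁ → Better N' x₂ →
                            (∀ y y' → Worse N' y → Worse N' y' → y ≡ y') → ⊥
    ¬two-better-one-worse N' x₁ x₂ x₁≢x₂ better₁ better₂ one = ℕP.<-irrefl refl (begin
      2            ≤⟨ count-≥2 _ x₁ x₂ x₁≢x₂ better₁ better₂ ⟩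
      φA G N' N    ≤⟨ apop N' ⟩
      φA G N N'    ≤⟨ count-≤1 _ one ⟩
      1            ∎)
      where open ℕP.≤-Reasoning

    ¬better-free : ∀ {x y} → T (E x y) → (∀ a → mA N a ≢ just y) → ¬ T (prefA G x (just y) (mA N x))
    ¬better-free {x} {y} xy free x⇝y = ¬one-better-none-worse N' x better none-worse
      where
      assign : Fin m → Maybe (Fin n)
      assign a = if does (a ≟ x) then just y else mA N a

      assign-x : assign x ≡ just y
      assign-x = if-yes (x ≟ x) refl

      assign⊆E : ∀ a b → assign a ≡ just b → T (E a b)
      assign⊆E a b eq with a ≟ x
      ... | yes refl = subst (T ∘ E a) (just-injective eq) xy
      ... | no _     = inE N a b eq

      assign-injective : ∀ a a' b → assign a ≡ just b → assign a' ≡ just b → a ≡ a'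
      assign-injective a a' b eq eq' with a ≟ x | a' ≟ x
      ... | yes a≡x  | yes a'≡x = trans a≡x (sym a'≡x)
      ... | yes refl | no _     = ⊥-elim (free a' (trans eq' (sym eq)))
      ... | no _     | yes refl = ⊥-elim (free a (trans eq (sym eq')))
      ... | no _     | no _     = N-injective eq eq'

      N' : Matching G
      N' = matchingFromA assign assign⊆E assign-injective

      better : Better N' x
      better = subst (λ z → T (prefA G x z (mA N x))) (sym assign-x) x⇝y

      none-worse : ∀ a → ¬ Worse N' a
      none-worse a worse with a ≟ x
      ... | yes refl = prefA-asym a (just y) (mA N a) x⇝y worse
      ... | no _     = prefA-irrefl a (mA N a) worse

    -- x₁ takes y₁ and x₂ takes y₂; whoever else held y₂ in N is left alone, and is the only one worse off.
    private
      module TwoMoves {x₁ x₂ : Fin m} {y₁ y₂ : Fin n} (x₁≢x₂ : x₁ ≢ x₂) (y₁≢y₂ : y₁ ≢ y₂)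
                      (x₁y₁ : T (E x₁ y₁)) (x₂y₂ : T (E x₂ y₂))
                      (y₁-holder : ∀ a → mA N a ≡ just y₁ → a ≡ x₁ ⊎ a ≡ x₂)
                      (x₁⇝y₁ : T (prefA G x₁ (just y₁) (mA N x₁)))
                      (x₂⇝y₂ : T (prefA G x₂ (just y₂) (mA N x₂))) where

        holds-y₂? : ∀ a → Dec (mA N a ≡ just y₂)
        holds-y₂? a = Maybe.≡-dec _≟_ (mA N a) (just y₂)

        assign : Fin m → Maybe (Fin n)
        assign a = if does (a ≟ x₁) then just y₁ else
                   if does (a ≟ x₂) then just y₂ else
                   if does (holds-y₂? a) then nothing else mA N a

        skip : ∀ {a} → a ≢ x₁ → a ≢ x₂ → assign a ≡ (if does (holds-y₂? a) then nothing else mA N a)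
        skip {a} a≢x₁ a≢x₂ = trans (if-no (a ≟ x₁) a≢x₁) (if-no (a ≟ x₂) a≢x₂)

        data Case (a : Fin m) : Set where
          first   : a ≡ x₁ → assign a ≡ just y₁ → Case a
          second  : a ≢ x₁ → a ≡ x₂ → assign a ≡ just y₂ → Case a
          evicted : a ≢ x₁ → a ≢ x₂ → mA N a ≡ just y₂ → assign a ≡ nothing → Case a
          kept    : a ≢ x₁ → a ≢ x₂ → mA N a ≢ just y₂ → assign a ≡ mA N a → Case a

        case : ∀ a → Case a
        case a with a ≟ x₁
        ... | yes p₁ = first p₁ (if-yes (a ≟ x₁) p₁)
        ... | no p₁ with a ≟ x₂
        ...   | yes p₂ = second p₁ p₂ (trans (if-no (a ≟ x₁) p₁) (if-yes (a ≟ x₂) p₂))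
        ...   | no p₂ with holds-y₂? a
        ...     | yes p₃ = evicted p₁ p₂ p₃ (trans (skip p₁ p₂) (if-yes (holds-y₂? a) p₃))
        ...     | no p₃  = kept p₁ p₂ p₃ (trans (skip p₁ p₂) (if-no (holds-y₂? a) p₃))

        assign⊆E : ∀ a b → assign a ≡ just b → T (E a b)
        assign⊆E a b eq with case a
        ... | first refl q     = subst (T ∘ E a) (just-injective (trans (sym q) eq)) x₁y₁
        ... | second _ refl q  = subst (T ∘ E a) (just-injective (trans (sym q) eq)) x₂y₂
        ... | evicted _ _ _ q with () ← trans (sym q) eq
        ... | kept _ _ _ q     = inE N a b (trans (sym q) eq)

        assign-injective : ∀ a a' b → assign a ≡ just b → assign a' ≡ just b → a ≡ a'
        assign-injective a a' b eq eq' with case a | case a'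
        ... | first p _    | first p' _    = trans p (sym p')
        ... | second _ p _ | second _ p' _ = trans p (sym p')
        ... | first _ q    | second _ _ q' =
          ⊥-elim (y₁≢y₂ (just-injective (trans (trans (sym q) eq) (trans (sym eq') q'))))
        ... | second _ _ q | first _ q'    =
          ⊥-elim (y₁≢y₂ (just-injective (trans (trans (sym q') eq') (trans (sym eq) q))))
        ... | evicted _ _ _ q | _ with () ← trans (sym q) eq
        ... | _ | evicted _ _ _ q with () ← trans (sym q) eq'
        ... | first _ q | kept a'≢x₁ a'≢x₂ _ q' =
          ⊥-elim ([ a'≢x₁ , a'≢x₂ ] (y₁-holder a' (trans (sym q') (trans eq' (trans (sym eq) q)))))
        ... | kept a≢x₁ a≢x₂ _ q | first _ q' =
          ⊥-elim ([ a≢x₁ , a≢x₂ ] (y₁-holder a (trans (sym q) (trans eq (trans (sym eq') q')))))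
        ... | second _ _ q | kept _ _ ¬y₂ q' = ⊥-elim (¬y₂ (trans (sym q') (trans eq' (trans (sym eq) q))))
        ... | kept _ _ ¬y₂ q | second _ _ q' = ⊥-elim (¬y₂ (trans (sym q) (trans eq (trans (sym eq') q'))))
        ... | kept _ _ _ q | kept _ _ _ q'   = N-injective (trans (sym q) eq) (trans (sym q') eq')

        N' : Matching G
        N' = matchingFromA assign assign⊆E assign-injective

        better₁ : Better N' x₁
        better₁ = subst (λ z → T (prefA G x₁ z (mA N x₁))) (sym (if-yes (x₁ ≟ x₁) refl)) x₁⇝y₁

        better₂ : Better N' x₂
        better₂ = subst (λ z → T (prefA G x₂ z (mA N x₂)))
                        (sym (trans (if-no (x₂ ≟ x₁) (x₁≢x₂ ∘ sym)) (if-yes (x₂ ≟ x₂) refl))) x₂⇝y₂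

        worse⇒evicted : ∀ a → Worse N' a → mA N a ≡ just y₂
        worse⇒evicted a worse with case a
        ... | first refl q    =
          ⊥-elim (prefA-asym a (just y₁) (mA N a) x₁⇝y₁ (subst (T ∘ prefA G a (mA N a)) q worse))
        ... | second _ refl q =
          ⊥-elim (prefA-asym a (just y₂) (mA N a) x₂⇝y₂ (subst (T ∘ prefA G a (mA N a)) q worse))
        ... | evicted _ _ p _ = p
        ... | kept _ _ _ q    = ⊥-elim (prefA-irrefl a (mA N a) (subst (T ∘ prefA G a (mA N a)) q worse))

        absurd : ⊥
        absurd = ¬two-better-one-worse N' x₁ x₂ x₁≢x₂ better₁ better₂
                   (λ a a' worse worse' → N-injective (worse⇒evicted a worse) (worse⇒evicted a' worse'))

    ¬two-better : ∀ {x₁ x₂ y₁ y₂} → x₁ ≢ x₂ → y₁ ≢ y₂ → T (E x₁ y₁) → T (E x₂ y₂) →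
                  (∀ a → mA N a ≡ just y₁ → a ≡ x₁ ⊎ a ≡ x₂) →
                  T (prefA G x₁ (just y₁) (mA N x₁)) → T (prefA G x₂ (just y₂) (mA N x₂)) → ⊥
    ¬two-better x₁≢x₂ y₁≢y₂ x₁y₁ x₂y₂ y₁-holder x₁⇝y₁ x₂⇝y₂ =
      TwoMoves.absurd x₁≢x₂ y₁≢y₂ x₁y₁ x₂y₂ y₁-holder x₁⇝y₁ x₂⇝y₂

    ¬better-non-FImage : ∀ {a b} → T (E a b) → ¬ IsFImage G b → ¬ T (prefA G a (just b) (mA N a))
    ¬better-non-FImage {a} {b} ab b∉F a⇝b with mB N b in Nb
    ... | nothing = ¬better-free ab (λ a' Na'≡b → just≢nothing (trans (sym (consAB N a' b Na'≡b)) Nb)) a⇝b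
    ... | just a₂ = ¬two-better a≢a₂ b≢f₂ ab (proj₁ f₂-first) b-holder a⇝b
                      (f-preferred N f₂-first
                         (λ Na₂≡f₂ → b≢f₂ (just-injective (trans (sym Na₂≡b) Na₂≡f₂))))
      where
      Na₂≡b : mA N a₂ ≡ just b
      Na₂≡b = consBA N a₂ b Nb

      f₂ : Fin n
      f₂ = proj₁ (f-exists (inE N a₂ b Na₂≡b))

      f₂-first : IsF G a₂ f₂
      f₂-first = proj₂ (f-exists (inE N a₂ b Na₂≡b))

      a≢a₂ : a ≢ a₂
      a≢a₂ refl = prefA-irrefl a (just b) (subst (T ∘ prefA G a (just b)) Na₂≡b a⇝b)

      b≢f₂ : b ≢ f₂
      b≢f₂ b≡f₂ = b∉F (a₂ , subst (IsF G a₂) (sym b≡f₂) f₂-first)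

      b-holder : ∀ a' → mA N a' ≡ just b → a' ≡ a ⊎ a' ≡ a₂
      b-holder a' Na'≡b = inj₂ (N-injective Na'≡b Na₂≡b)

    non-f-partner-not-FImage : ∀ {a b} → mA N a ≡ just b → ¬ IsF G a b → ¬ IsFImage G b
    non-f-partner-not-FImage {a} {b} Na≡b ¬ab-first (a' , a'b-first) with a' ≟ a
    ... | yes refl = ¬ab-first a'b-first
    ... | no a'≢a  = ¬two-better a'≢a b≢f (proj₁ a'b-first) (proj₁ f-first) b-holder
                       (f-preferred N a'b-first (λ Na'≡b → a'≢a (N-injective Na'≡b Na≡b)))
                       (f-preferred N f-first (λ Na≡f → b≢f (just-injective (trans (sym Na≡b) Na≡f))))
      where
      f : Fin n
      f = proj₁ (f-exists (inE N a b Na≡b))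

      f-first : IsF G a f
      f-first = proj₂ (f-exists (inE N a b Na≡b))

      b≢f : b ≢ f
      b≢f b≡f = ¬ab-first (subst (IsF G a) (sym b≡f) f-first)

      b-holder : ∀ a'' → mA N a'' ≡ just b → a'' ≡ a' ⊎ a'' ≡ a
      b-holder a'' Na''≡b = inj₂ (N-injective Na''≡b Na≡b)

    matched-valid : ∀ {a b} → mA N a ≡ just b → ValidEdge G a b
    matched-valid {a} {b} Na≡b with IsF? a b
    ... | yes ab-first = inj₁ ab-first
    ... | no ¬ab-first = inj₂ (inE N a b Na≡b , non-f-partner-not-FImage Na≡b ¬ab-first , b-best)
      where
      b-best : ∀ b' → T (E a b') → ¬ IsFImage G b' → rkA a b ≤ rkA a b'
      b-best b' ab' b'∉F = ℕP.≮⇒≥ λ b'<b →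
        ¬better-non-FImage ab' b'∉F (subst (T ∘ prefA G a (just b')) (sym Na≡b) (ℕP.<⇒<ᵇ b'<b))

    unmatchedA-valid : ∀ {a} → mA N a ≡ nothing → ValidLoop G (inj₁ a)
    unmatchedA-valid {a} Na≡∅ b ab with IsFImage? b
    ... | yes b∈F = b∈F
    ... | no b∉F  = ⊥-elim (¬better-non-FImage ab b∉F (subst (T ∘ prefA G a (just b)) (sym Na≡∅) _))

    unmatchedB-valid : ∀ {b} → mB N b ≡ nothing → ValidLoop G (inj₂ b)
    unmatchedB-valid {b} Nb≡∅ (a , ab-first) =
      ¬better-free (proj₁ ab-first) free (f-preferred N ab-first (free a))
      where
      free : ∀ a' → mA N a' ≢ just b
      free a' Na'≡b = just≢nothing (trans (sym (consAB N a' b Na'≡b)) Nb≡∅)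

  -- Complementary slackness

  module Slackness (N : Matching G) (α : V G → ℤ) (wit : Witness G N α) where
    private
      αA : Fin m → ℤ
      αA a = α (inj₁ a)

      αB : Fin n → ℤ
      αB b = α (inj₂ b)

      edge-constraint : ∀ a b → T (E a b) → wt G N a b ℤ.≤ α (inj₁ a) ℤ.+ α (inj₂ b)
      edge-constraint = proj₁ (proj₂ (proj₂ wit))

      loop-constraint : ∀ u → wtLoop G N u ℤ.≤ α u
      loop-constraint = proj₂ (proj₂ (proj₂ wit))

      partnerValue : Maybe (Fin n) → ℤ
      partnerValue nothing  = + 0
      partnerValue (just b) = αB b

      ifMatched ifSingle : Maybe (Fin m) → ℤ → ℤ
      ifMatched nothing  _ = + 0
      ifMatched (just _) x = x
      ifSingle  nothing  x = x
      ifSingle  (just _) _ = + 0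

      matched+single : ∀ y x → ifMatched y x ℤ.+ ifSingle y x ≡ x
      matched+single nothing  x = ℤP.+-identityˡ x
      matched+single (just _) x = ℤP.+-identityʳ x

      matches? : ∀ a b → Dec (mA N a ≡ just b)
      matches? a b = Maybe.≡-dec _≟_ (mA N a) (just b)

      -- Summed by rows and by columns it gives Σ_a α_N(a) = Σ_{b matched} α_b.
      incidence : Fin m → Fin n → ℤ
      incidence a b = if does (matches? a b) then αB b else + 0

      row-sum : ∀ a y → mA N a ≡ y → sum (incidence a) ≡ partnerValue y
      row-sum a nothing Na≡∅ =
        sum-zero (incidence a)
                 (λ b → if-no (matches? a b) (λ Na≡b → just≢nothing (trans (sym Na≡b) Na≡∅)))
      row-sum a (just b) Na≡b =
        trans (sum-single (incidence a) b (λ b' b'≢b → if-no (matches? a b')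
                 (λ Na≡b' → b'≢b (just-injective (trans (sym Na≡b') Na≡b)))))
              (if-yes (matches? a b) Na≡b)

      column-sum : ∀ b y → mB N b ≡ y → sum (λ a → incidence a b) ≡ ifMatched y (αB b)
      column-sum b nothing Nb≡∅ =
        sum-zero (λ a → incidence a b)
                 (λ a → if-no (matches? a b)
                          (λ Na≡b → just≢nothing (trans (sym (consAB N a b Na≡b)) Nb≡∅)))
      column-sum b (just a) Nb≡a =
        trans (sum-single (λ a' → incidence a' b) a (λ a' a'≢a → if-no (matches? a' b)
                 (λ Na'≡b → a'≢a (just-injective (trans (sym (consAB N a' b Na'≡b)) Nb≡a)))))
              (if-yes (matches? a b) (consBA N a b Nb≡a))

      partner-sum : sum (λ a → partnerValue (mA N a)) ≡ sum (λ b → ifMatched (mB N b) (αB b))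
      partner-sum = begin
        sum (λ a → partnerValue (mA N a))       ≡⟨ sum-cong-≗ (λ a → row-sum a _ refl) ⟨
        sum (λ a → sum (incidence a))           ≡⟨ ∑-comm incidence ⟩
        sum (λ b → sum (λ a → incidence a b))   ≡⟨ sum-cong-≗ (λ b → column-sum b _ refl) ⟩
        sum (λ b → ifMatched (mB N b) (αB b))   ∎
        where open ≡-Reasoning

      excess : Fin m → ℤ
      excess a = αA a ℤ.+ partnerValue (mA N a)

      singleB : Fin n → ℤ
      singleB b = ifSingle (mB N b) (αB b)

      total : sum excess ℤ.+ sum singleB ≡ + 0
      total = begin
        sum excess ℤ.+ sum singleB
          ≡⟨ cong (ℤ._+ sum singleB) (∑-distrib-+ αA (λ a → partnerValue (mA N a))) ⟩
        (sum αA ℤ.+ sum (λ a → partnerValue (mA N a))) ℤ.+ sum singleB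
          ≡⟨ cong (λ s → (sum αA ℤ.+ s) ℤ.+ sum singleB) partner-sum ⟩
        (sum αA ℤ.+ sum matchedB) ℤ.+ sum singleB
          ≡⟨ ℤP.+-assoc (sum αA) (sum matchedB) (sum singleB) ⟩
        sum αA ℤ.+ (sum matchedB ℤ.+ sum singleB)
          ≡⟨ cong (ℤ._+_ (sum αA)) (∑-distrib-+ matchedB singleB) ⟨
        sum αA ℤ.+ sum (λ b → matchedB b ℤ.+ singleB b)
          ≡⟨ cong (ℤ._+_ (sum αA)) (sum-cong-≗ (λ b → matched+single (mB N b) (αB b))) ⟩
        sum αA ℤ.+ sum αB
          ≡⟨ cong₂ ℤ._+_ (sumℤ≡sum αA) (sumℤ≡sum αB) ⟨
        sumℤ αA ℤ.+ sumℤ αB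
          ≡⟨ proj₁ (proj₂ wit) ⟩
        + 0 ∎
        where
        open ≡-Reasoning
        matchedB : Fin n → ℤ
        matchedB b = ifMatched (mB N b) (αB b)

      excess≥0 : ∀ a y → mA N a ≡ y → + 0 ℤ.≤ αA a ℤ.+ partnerValue y
      excess≥0 a nothing Na≡∅ =
        subst₂ ℤ._≤_ loop-weight (sym (ℤP.+-identityʳ (αA a))) (loop-constraint (inj₁ a))
        where
        loop-weight : wtLoopA G N a ≡ + 0
        loop-weight rewrite Na≡∅ = refl
      excess≥0 a (just b) Na≡b = subst (ℤ._≤ αA a ℤ.+ αB b) (wt-matched N a b Na≡b)
                                       (edge-constraint a b (inE N a b Na≡b))

      singleB≥0 : ∀ b y → mB N b ≡ y → + 0 ℤ.≤ ifSingle y (αB b)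
      singleB≥0 b nothing Nb≡∅ = subst (ℤ._≤ αB b) loop-weight (loop-constraint (inj₂ b))
        where
        loop-weight : wtLoopB G N b ≡ + 0
        loop-weight rewrite Nb≡∅ = refl
      singleB≥0 b (just _) _ = ℤP.≤-refl

      excess≡0 : ∀ a → excess a ≡ + 0
      excess≡0 =
        nonneg-sum≤0 excess (λ a → excess≥0 a _ refl) (ℤP.≤-trans Σexcess≤total (ℤP.≤-reflexive total))
        where
        Σexcess≤total : sum excess ℤ.≤ sum excess ℤ.+ sum singleB
        Σexcess≤total = x≤x+y (sum excess) (sum-nonneg singleB (λ b → singleB≥0 b _ refl))

      singleB≡0 : ∀ b → singleB b ≡ + 0
      singleB≡0 =
        nonneg-sum≤0 singleB (λ b → singleB≥0 b _ refl) (ℤP.≤-trans ΣsingleB≤total (ℤP.≤-reflexive total))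
        where
        ΣsingleB≤total : sum singleB ℤ.≤ sum excess ℤ.+ sum singleB
        ΣsingleB≤total = subst (sum singleB ℤ.≤_) (ℤP.+-comm (sum singleB) (sum excess))
                               (x≤x+y (sum singleB) (sum-nonneg excess (λ a → excess≥0 a _ refl)))

    slack-matched : ∀ {a b} → mA N a ≡ just b → α (inj₁ a) ℤ.+ α (inj₂ b) ≡ + 0
    slack-matched {a} Na≡b = trans (cong (λ y → αA a ℤ.+ partnerValue y) (sym Na≡b)) (excess≡0 a)

    slack-unmatchedA : ∀ {a} → mA N a ≡ nothing → α (inj₁ a) ≡ + 0
    slack-unmatchedA {a} Na≡∅ =
      trans (sym (ℤP.+-identityʳ (αA a)))
            (trans (cong (λ y → αA a ℤ.+ partnerValue y) (sym Na≡∅)) (excess≡0 a))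

    slack-unmatchedB : ∀ {b} → mB N b ≡ nothing → α (inj₂ b) ≡ + 0
    slack-unmatchedB {b} Nb≡∅ = trans (cong (λ y → ifSingle y (αB b)) (sym Nb≡∅)) (singleB≡0 b)

  -- The legal stable matching of H lifted from N and α

  adj-sym : ∀ u v → AdjV G u v → AdjV G v u
  adj-sym (inj₁ a) (inj₂ b) ab = ab
  adj-sym (inj₂ b) (inj₁ a) ab = ab

  sameV-refl : ∀ u → sameV G u u ≡ true
  sameV-refl u = dec-true (Data.Sum.Properties.≡-dec _≟_ _≟_ u u) refl

  keyL-loop : ∀ u → keyL G u u minus ≡ (2 , 0)
  keyL-loop u rewrite sameV-refl u = refl

  keyR-loop : ∀ u → keyR G u u minus ≡ (1 , 0)
  keyR-loop u rewrite sameV-refl u = refl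

  keyL-minus : ∀ u v → AdjV G u v → keyL G u v minus ≡ (1 , rankV G u v)
  keyL-minus (inj₁ _) (inj₂ _) _ = refl
  keyL-minus (inj₂ _) (inj₁ _) _ = refl

  keyR-minus : ∀ u v → AdjV G u v → keyR G u v minus ≡ (0 , rankV G v u)
  keyR-minus (inj₁ _) (inj₂ _) _ = refl
  keyR-minus (inj₂ _) (inj₁ _) _ = refl

  keyL-adj≤1 : ∀ {u v} → AdjV G u v → ∀ σ → proj₁ (keyL G u v σ) ≤ 1
  keyL-adj≤1                   _ plus  = z≤n
  keyL-adj≤1 {inj₁ a} {inj₂ b} _ minus = s≤s z≤n
  keyL-adj≤1 {inj₂ b} {inj₁ a} _ minus = s≤s z≤n

  module Lift (N : Matching G) (pop : Popular G N) (apop : APopular G N)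
              (α : V G → ℤ) (wit : Witness G N α) where
    open FromAPopularity N apop
    open Slackness N α wit

    α-range : ∀ u → α u ≡ - (+ 1) ⊎ α u ≡ + 0 ⊎ α u ≡ + 1
    α-range = proj₁ wit

    private
      edge-constraint : ∀ a b → T (E a b) → wt G N a b ℤ.≤ α (inj₁ a) ℤ.+ α (inj₂ b)
      edge-constraint = proj₁ (proj₂ (proj₂ wit))

    data Partners : V G → V G → Set where
      a-side : ∀ {a b} → mA N a ≡ just b → Partners (inj₁ a) (inj₂ b)
      b-side : ∀ {a b} → mB N b ≡ just a → Partners (inj₂ b) (inj₁ a)

    Single : V G → Set
    Single (inj₁ a) = mA N a ≡ nothing
    Single (inj₂ b) = mB N b ≡ nothing

    data Status (u : V G) : Set where
      partnered : ∀ {w} → Partners u w → Status u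
      alone     : Single u → Status u

    status : ∀ u → Status u
    status (inj₁ a) with mA N a in Na
    ... | just _  = partnered (a-side Na)
    ... | nothing = alone Na
    status (inj₂ b) with mB N b in Nb
    ... | just _  = partnered (b-side Nb)
    ... | nothing = alone Nb

    partners-sym : ∀ {u w} → Partners u w → Partners w u
    partners-sym (a-side {a} {b} Na≡b) = b-side (consAB N a b Na≡b)
    partners-sym (b-side {a} {b} Nb≡a) = a-side (consBA N a b Nb≡a)

    partners-adj : ∀ {u w} → Partners u w → AdjV G u w
    partners-adj (a-side {a} {b} Na≡b) = inE N a b Na≡b
    partners-adj (b-side {a} {b} Nb≡a) = inE N a b (consBA N a b Nb≡a)

    partners-unique : ∀ {u w w'} → Partners u w → Partners u w' → w ≡ w'
    partners-unique (a-side e) (a-side e') = cong inj₂ (just-injective (trans (sym e) e'))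
    partners-unique (b-side e) (b-side e') = cong inj₁ (just-injective (trans (sym e) e'))

    partners-not-single : ∀ {u w} → Partners u w → ¬ Single u
    partners-not-single (a-side e) s = just≢nothing (trans (sym e) s)
    partners-not-single (b-side e) s = just≢nothing (trans (sym e) s)

    slack-partners : ∀ {u w} → Partners u w → α u ℤ.+ α w ≡ + 0
    slack-partners (a-side e)         = slack-matched e
    slack-partners (b-side {a} {b} e) =
      trans (ℤP.+-comm (α (inj₂ b)) (α (inj₁ a))) (slack-matched (consBA N a b e))

    slack-single : ∀ {u} → Single u → α u ≡ + 0
    slack-single {inj₁ _} = slack-unmatchedA
    slack-single {inj₂ _} = slack-unmatchedB

    Prefers : V G → V G → Set
    Prefers (inj₁ a) (inj₂ b) = T (prefA G a (just b) (mA N a))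
    Prefers (inj₂ b) (inj₁ a) = T (prefB G b (just a) (mB N b))
    Prefers _        _        = ⊥

    prefers-over-single : ∀ {u v} → Single u → AdjV G u v → Prefers u v
    prefers-over-single {inj₁ _} {inj₂ _} s _ rewrite s = _
    prefers-over-single {inj₂ _} {inj₁ _} s _ rewrite s = _

    prefers-over-partner : ∀ {u v x} → Partners u x → AdjV G u v → rankV G u v < rankV G u x → Prefers u v
    prefers-over-partner {v = inj₂ _} (a-side e) _ v<x rewrite e = ℕP.<⇒<ᵇ v<x
    prefers-over-partner {v = inj₁ _} (b-side e) _ v<x rewrite e = ℕP.<⇒<ᵇ v<x

    ¬mutual-pref : ∀ {u v} → AdjV G u v → Prefers u v → Prefers v u → ¬ (α u ℤ.+ α v ℤ.≤ + 1)
    ¬mutual-pref {u} {v} uv u⇝v v⇝u sum≤1 with ℤP.≤-trans (weight uv u⇝v v⇝u) sum≤1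
      where
      weight : ∀ {u v} → AdjV G u v → Prefers u v → Prefers v u → + 2 ℤ.≤ α u ℤ.+ α v
      weight {inj₁ a} {inj₂ b} ab a⇝b b⇝a =
        subst (ℤ._≤ _) (wt-mutual N a b a⇝b b⇝a) (edge-constraint a b ab)
      weight {inj₂ b} {inj₁ a} ab b⇝a a⇝b =
        subst₂ ℤ._≤_ (wt-mutual N a b a⇝b b⇝a) (ℤP.+-comm (α (inj₁ a)) (α (inj₂ b))) (edge-constraint a b ab)
    ... | +≤+ (s≤s ())

    ¬one-pref : ∀ {u v} → AdjV G u v → Prefers u v ⊎ Prefers v u → ¬ (α u ℤ.+ α v ℤ.≤ - (+ 1))
    ¬one-pref {u} {v} uv pref sum≤-1 with ℤP.≤-trans (weight uv pref) sum≤-1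
      where
      weight : ∀ {u v} → AdjV G u v → Prefers u v ⊎ Prefers v u → + 0 ℤ.≤ α u ℤ.+ α v
      weight {inj₁ a} {inj₂ b} ab pref = ℤP.≤-trans (wt-nonneg N a b pref) (edge-constraint a b ab)
      weight {inj₂ b} {inj₁ a} ab pref =
        subst (+ 0 ℤ.≤_) (ℤP.+-comm (α (inj₁ a)) (α (inj₂ b)))
              (ℤP.≤-trans (wt-nonneg N a b (swap pref)) (edge-constraint a b ab))
    ... | ()

    sign : ℤ → Sign
    sign (+ 1) = plus
    sign _     = minus

    data SignView (u : V G) : Set where
      positive    : α u ≡ + 1 → sign (α u) ≡ plus → SignView u
      nonpositive : α u ℤ.≤ + 0 → sign (α u) ≡ minus → SignView u

    signView : ∀ u → SignView u
    signView u with α-range u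
    ... | inj₁ α≡-1       = nonpositive (-1⇒≤0 α≡-1) (cong sign α≡-1)
    ... | inj₂ (inj₁ α≡0) = nonpositive (ℤP.≤-reflexive α≡0) (cong sign α≡0)
    ... | inj₂ (inj₂ α≡1) = positive α≡1 (cong sign α≡1)

    α≤1 : ∀ u → α u ℤ.≤ + 1
    α≤1 u with α-range u
    ... | inj₁ α≡-1       = ℤP.≤-trans (-1⇒≤0 α≡-1) (+≤+ z≤n)
    ... | inj₂ (inj₁ α≡0) = ℤP.≤-trans (ℤP.≤-reflexive α≡0) (+≤+ z≤n)
    ... | inj₂ (inj₂ α≡1) = ℤP.≤-reflexive α≡1

    partner-of-positive : ∀ {v w} → Partners v w → α w ≡ + 1 → α v ≡ - (+ 1)
    partner-of-positive {v} {w} p α≡1 = trans (inverseˡ-unique (α v) (α w) (slack-partners p)) (cong -_ α≡1)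

    partner-of-negative : ∀ {v w} → Partners v w → α v ≡ - (+ 1) → α w ≡ + 1
    partner-of-negative {v} {w} p α≡-1 =
      trans (inverseʳ-unique (α v) (α w) (slack-partners p)) (cong -_ α≡-1)

    data Lifted : V G → V G → Sign → Set where
      lift-pair : ∀ {u w} → Partners u w → Lifted u w (sign (α u))
      lift-loop : ∀ {u} → Single u → Lifted u u minus

    lifted-sub : ∀ u v σ → Lifted u v σ → IsHEdge G u v σ
    lifted-sub _ _ _ (lift-pair p) = inj₁ (partners-adj p)
    lifted-sub _ _ _ (lift-loop _) = inj₂ (refl , refl)

    lifted-uniqueL : ∀ u v σ v' σ' → Lifted u v σ → Lifted u v' σ' → v ≡ v' × σ ≡ σ'
    lifted-uniqueL _ _ _ _ _ (lift-pair p) (lift-pair p') = partners-unique p p' , refl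
    lifted-uniqueL _ _ _ _ _ (lift-pair p) (lift-loop s)  = ⊥-elim (partners-not-single p s)
    lifted-uniqueL _ _ _ _ _ (lift-loop s) (lift-pair p)  = ⊥-elim (partners-not-single p s)
    lifted-uniqueL _ _ _ _ _ (lift-loop _) (lift-loop _)  = refl , refl

    lifted-uniqueR : ∀ u v σ u' σ' → Lifted u v σ → Lifted u' v σ' → u ≡ u' × σ ≡ σ'
    lifted-uniqueR u _ _ u' _ (lift-pair p) (lift-pair p') = u≡u' , cong (sign ∘ α) u≡u'
      where
      u≡u' : u ≡ u'
      u≡u' = partners-unique (partners-sym p) (partners-sym p')
    lifted-uniqueR _ _ _ _ _ (lift-pair p) (lift-loop s)  = ⊥-elim (partners-not-single (partners-sym p) s)
    lifted-uniqueR _ _ _ _ _ (lift-loop s) (lift-pair p)  = ⊥-elim (partners-not-single (partners-sym p) s)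
    lifted-uniqueR _ _ _ _ _ (lift-loop _) (lift-loop _)  = refl , refl

    lifted : HMatching G
    lifted = record { S = Lifted ; sub = lifted-sub ; uniqL = lifted-uniqueL ; uniqR = lifted-uniqueR }

    lifted-edge : ∀ u → Σ (V G) λ v → Σ Sign (Lifted u v)
    lifted-edge u with status u
    ... | partnered {w} p = w , sign (α u) , lift-pair p
    ... | alone s         = u , minus , lift-loop s

    lifted-legal : LegalMatching G lifted
    lifted-legal _ _ _ (lift-pair (a-side e))         = matched-valid e , N , pop , e
    lifted-legal _ _ _ (lift-pair (b-side {a} {b} e)) = matched-valid e' , N , pop , e'
      where e' = consBA N a b e
    lifted-legal (inj₁ _) _ _ (lift-loop s) = unmatchedA-valid s , N , pop , s
    lifted-legal (inj₂ _) _ _ (lift-loop s) = unmatchedB-valid s , N , pop , s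

    BeatsLeft BeatsRight : V G → V G → Sign → Set
    BeatsLeft  u v σ = ∀ v' σ' → Lifted u v' σ' → keyL G u v σ <ₗ keyL G u v' σ'
    BeatsRight u v σ = ∀ u' σ' → Lifted u' v σ' → keyR G u v σ <ₗ keyR G u' v σ'

    ¬loop-beats : ∀ u → ¬ BeatsLeft u u minus
    ¬loop-beats u beats with status u
    ... | alone s         = <ₗ-irrefl (beats u minus (lift-loop s))
    ... | partnered {x} p =
      ℕP.1+n≰n (ℕP.≤-trans (<ₗ-fst _ key<) (keyL-adj≤1 (partners-adj p) (sign (α u))))
      where
      key< : (2 , 0) <ₗ keyL G u x (sign (α u))
      key< = subst (_<ₗ keyL G u x (sign (α u))) (keyL-loop u) (beats x _ (lift-pair p))

    left-plus : ∀ {u v} → AdjV G u v → BeatsLeft u v plus →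
                (Prefers u v × α u ℤ.≤ + 1) ⊎ α u ℤ.≤ + 0
    left-plus {u} {v} uv beats with status u
    ... | alone s         = inj₁ (prefers-over-single s uv , α≤1 u)
    ... | partnered {x} p with signView u
    ...   | nonpositive α≤0 _ = inj₂ α≤0
    ...   | positive _ sg     = inj₁ (prefers-over-partner p uv (<ₗ-snd key<) , α≤1 u)
      where
      key< : (0 , rankV G u v) <ₗ (0 , rankV G u x)
      key< = subst (λ σ → keyL G u v plus <ₗ keyL G u x σ) sg (beats x _ (lift-pair p))

    left-minus : ∀ {u v} → AdjV G u v → BeatsLeft u v minus → Prefers u v × α u ℤ.≤ + 0
    left-minus {u} {v} uv beats with status u
    ... | alone s         = prefers-over-single s uv , ℤP.≤-reflexive (slack-single s)
    ... | partnered {x} p with signView u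
    ...   | positive _ sg = ⊥-elim (ℕP.≤⇒≯ (<ₗ-fst _ key<) (s≤s z≤n))
      where
      key< : (1 , rankV G u v) <ₗ keyL G u x plus
      key< = subst₂ _<ₗ_ (keyL-minus u v uv) (cong (keyL G u x) sg) (beats x _ (lift-pair p))
    ...   | nonpositive α≤0 sg = prefers-over-partner p uv (<ₗ-snd key<) , α≤0
      where
      key< : (1 , rankV G u v) <ₗ (1 , rankV G u x)
      key< = subst₂ _<ₗ_ (keyL-minus u v uv) (trans (cong (keyL G u x) sg) (keyL-minus u x (partners-adj p)))
                    (beats x _ (lift-pair p))

    right-plus : ∀ {u v} → AdjV G u v → BeatsRight u v plus → Prefers v u × α v ≡ - (+ 1)
    right-plus {u} {v} uv beats with status v
    ... | alone s = ⊥-elim (ℕP.1+n≰n (<ₗ-fst _ key<))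
      where
      key< : (2 , rankV G v u) <ₗ (1 , 0)
      key< = subst (keyR G u v plus <ₗ_) (keyR-loop v) (beats v minus (lift-loop s))
    ... | partnered {w} p with signView w
    ...   | nonpositive _ sg = ⊥-elim (ℕP.≤⇒≯ (<ₗ-fst _ key<) (s≤s z≤n))
      where
      p′ : Partners w v
      p′ = partners-sym p
      key< : (2 , rankV G v u) <ₗ (0 , rankV G v w)
      key< = subst (keyR G u v plus <ₗ_) (trans (cong (keyR G w v) sg) (keyR-minus w v (partners-adj p′)))
                   (beats w _ (lift-pair p′))
    ...   | positive α≡1 sg =
      prefers-over-partner p (adj-sym u v uv) (<ₗ-snd key<) , partner-of-positive p α≡1
      where
      key< : (2 , rankV G v u) <ₗ (2 , rankV G v w)
      key< = subst (λ σ → keyR G u v plus <ₗ keyR G w v σ) sg (beats w _ (lift-pair (partners-sym p)))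

    right-minus : ∀ {u v} → AdjV G u v → BeatsRight u v minus →
                  (Prefers v u × α v ℤ.≤ + 1) ⊎ α v ≡ - (+ 1)
    right-minus {u} {v} uv beats with status v
    ... | alone s = inj₁ (prefers-over-single s (adj-sym u v uv) , α≤1 v)
    ... | partnered {w} p with signView w
    ...   | positive α≡1 _   = inj₂ (partner-of-positive p α≡1)
    ...   | nonpositive _ sg = inj₁ (prefers-over-partner p (adj-sym u v uv) (<ₗ-snd key<) , α≤1 v)
      where
      p′ : Partners w v
      p′ = partners-sym p
      key< : (0 , rankV G v u) <ₗ (0 , rankV G v w)
      key< = subst₂ _<ₗ_ (keyR-minus u v uv) (trans (cong (keyR G w v) sg) (keyR-minus w v (partners-adj p′)))
                    (beats w _ (lift-pair p′))

    lifted-stable : Stable G lifted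
    lifted-stable u .u .minus (inj₂ (refl , refl) , beatsL , _) = ¬loop-beats u beatsL
    lifted-stable u v plus (inj₁ uv , beatsL , beatsR) with left-plus uv beatsL | right-plus uv beatsR
    ... | inj₁ (u⇝v , αu≤1) | v⇝u , αv≡-1 = ¬mutual-pref uv u⇝v v⇝u (ℤP.+-mono-≤ αu≤1 (-1⇒≤0 αv≡-1))
    ... | inj₂ αu≤0         | v⇝u , αv≡-1 = ¬one-pref uv (inj₂ v⇝u) (ℤP.+-mono-≤ αu≤0 (ℤP.≤-reflexive αv≡-1))
    lifted-stable u v minus (inj₁ uv , beatsL , beatsR) with left-minus uv beatsL | right-minus uv beatsR
    ... | u⇝v , αu≤0 | inj₁ (v⇝u , αv≤1) = ¬mutual-pref uv u⇝v v⇝u (ℤP.+-mono-≤ αu≤0 αv≤1)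
    ... | u⇝v , αu≤0 | inj₂ αv≡-1        = ¬one-pref uv (inj₁ u⇝v) (ℤP.+-mono-≤ αu≤0 (ℤP.≤-reflexive αv≡-1))

    negative-partner-edge : ∀ {v w} → Partners v w → α v ≡ - (+ 1) → Lifted w v plus
    negative-partner-edge p α≡-1 =
      subst (Lifted _ _) (cong sign (partner-of-negative p α≡-1)) (lift-pair (partners-sym p))

    A₋⇒α≢1 : (S₀ : HMatching G) → LeftOptimal G S₀ → ∀ {a b} → S S₀ (inj₁ a) (inj₂ b) minus → α (inj₁ a) ≢ + 1
    A₋⇒α≢1 S₀ (_ , optimal) {a} a⁻ α≡1 with status (inj₁ a)
    ... | alone s with () ← trans (sym α≡1) (slack-single s)
    ... | partnered {x} p
          with optimal lifted (lifted-legal , lifted-stable) (inj₁ a) x plus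
                       (subst (Lifted (inj₁ a) x) (cong sign α≡1) (lift-pair p))
    ...   | _ , _ , S₀-edge , same-or-better with uniqL S₀ _ _ _ _ _ a⁻ S₀-edge
    ...     | refl , refl with same-or-better
    ...       | inj₁ (_ , ())
    ...       | inj₂ key<     = ℕP.≤⇒≯ (<ₗ-fst _ key<) (s≤s z≤n)

    A′₊⇒α≢-1 : (S₀ : HMatching G) → LeftOptimal G S₀ → ∀ {a b} → S S₀ (inj₂ b) (inj₁ a) minus → α (inj₁ a) ≢ - (+ 1)
    A′₊⇒α≢-1 S₀ (_ , optimal) {a} {b} b⁻a⁺ α≡-1 with status (inj₁ a)
    ... | alone s with () ← trans (sym α≡-1) (slack-single s)
    ... | partnered p with lifted-edge (inj₂ b)
    ...   | v , σ , b-edge with optimal lifted (lifted-legal , lifted-stable) (inj₂ b) v σ b-edge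
    ...     | _ , _ , S₀-edge , same-or-better with uniqL S₀ _ _ _ _ _ b⁻a⁺ S₀-edge
    ...       | refl , refl with same-or-better
    ...         | inj₁ (refl , refl) with () ← proj₂ (lifted-uniqueR _ _ _ _ _ b-edge (negative-partner-edge p α≡-1))
    ...         | inj₂ key< = lifted-stable (inj₂ b) (inj₁ a) minus (sub S₀ _ _ _ b⁻a⁺ , beatsL , beatsR)
      where
      beatsL : BeatsLeft (inj₂ b) (inj₁ a) minus
      beatsL v' σ' b-edge' with lifted-uniqueL _ _ _ _ _ b-edge b-edge'
      ... | refl , refl = key<
      beatsR : BeatsRight (inj₂ b) (inj₁ a) minus
      beatsR u' σ' a-edge with lifted-uniqueR _ _ _ _ _ (negative-partner-edge p α≡-1) a-edge
      ... | refl , refl = inj₁ (s≤s z≤n)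

lemma2 : (G : Instance) →
    Σ (HMatching G) (λ S → LegalStable G S) →
    (S₀ : HMatching G) → LeftOptimal G S₀ →
    (N : Matching G) → FullyPopular G N →
    (α : V G → ℤ) → Witness G N α →
    (a : Fin (Instance.m G)) →
    Σ (Fin (Instance.n G)) (λ b → S S₀ (inj₁ a) (inj₂ b) minus) →
    Σ (Fin (Instance.n G)) (λ b → S S₀ (inj₂ b) (inj₁ a) minus) →
    α (inj₁ a) ≡ + 0
lemma2 G _ S₀ optimal N (pop , apop) α wit a (_ , a⁻) (_ , a⁺) = α≡0
  where
  open Lift G N pop apop α wit

  α≡0 : α (inj₁ a) ≡ + 0
  α≡0 with α-range (inj₁ a)
  ... | inj₁ α≡-1       = ⊥-elim (A′₊⇒α≢-1 S₀ optimal a⁺ α≡-1)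
  ... | inj₂ (inj₁ α≡0) = α≡0
  ... | inj₂ (inj₂ α≡1) = ⊥-elim (A₋⇒α≢1 S₀ optimal a⁻ α≡1)
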